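{- Let $\mathbf L$ be any substructural logic with $\mathbf{FL}_{\mathbf{ew}}\subseteq\mathbf L\subseteq\mathbf{IPL}$, and let ${\Rightarrow}\in\{\Rightarrow_{\wedge},\Rightarrow_{\circ}\}$. The following are equivalent: (1) $(\mathbf L,{\Rightarrow})$ is a connexive logic; (2) at least one of Aristotle's theses $\neg(\varphi{\Rightarrow}\neg\varphi)$, $\neg(\neg\varphi{\Rightarrow}\varphi)$ is a theorem (for all formulas $\varphi$) of $\mathbf L$; (3) $\mathbf L$ is an axiomatic extension of $\mathbf G_{\mathbf{FL}_{\mathbf{ew}}}(\mathbf{CPL})$.
   Context: Formulas are built from variables in the language $\{\wedge,\vee,\cdot,\to,0,1\}$; $\neg\varphi:=\varphi\to 0$, $\varphi\Rightarrow_{\wedge}\psi:=(\varphi\to\psi)\wedge(\psi\to\neg\neg\varphi)$, $\varphi\Rightarrow_{\circ}\psi:=(\varphi\to\psi)\cdot(\psi\to\neg\neg\varphi)$. $\mathbf{FL}_{\mathbf e}$ is the (external) logic of the Full Lambek calculus with exchange; substructural logics are its axiomatic extensions; $\mathbf{FL}_{\mathbf{ew}}$ is its extension by weakening. An FL${}_{\mathrm e}$-algebra is an algebra $\langle A,\wedge,\vee,\cdot,\to,0,1\rangle$ with a lattice reduct (order $\leq$), commutative monoid reduct $\langle A,\cdot,1\rangle$, arbitrary constant $0$, and $x\cdot y\leq z\iff x\leq y\to z$. Each substructural logic $\mathbf L$ is algebraizable with equivalent algebraic semantics a variety $\mathsf V(\mathbf L)$ of FL${}_{\mathrm e}$-algebras,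 with $\vdash_{\mathbf L}\varphi$ iff $\mathsf V(\mathbf L)\models 1\leq\varphi$; $\mathbf{FL}_{\mathbf{ew}}$ corresponds to FL${}_{\mathrm e}$-algebras with $1$ greatest and $0$ least, $\mathbf{IPL}$ to Heyting algebras, $\mathbf{CPL}$ to Boolean algebras. $\mathbf G_{\mathbf{FL}_{\mathbf e}}(\mathbf{CPL})$ is the least substructural logic $\mathbf K$ such that for every formula $\varphi$, $\vdash_{\mathbf{CPL}}\varphi$ iff $\vdash_{\mathbf K}\neg\neg\varphi$, and $\mathbf G_{\mathbf{FL}_{\mathbf{ew}}}(\mathbf{CPL})$ is the smallest substructural logic containing both $\mathbf G_{\mathbf{FL}_{\mathbf e}}(\mathbf{CPL})$ and $\mathbf{FL}_{\mathbf{ew}}$. For a term-defined binary connective ${\Rightarrow}$: $(\mathbf L,{\Rightarrow})$ is proto-connexive if every member of $\mathsf V(\mathbf L)$ satisfies, for all $x,y$, $1\leq\neg(x{\Rightarrow}\neg x)$, $1\leq\neg(\neg x{\Rightarrow} x)$, $1\leq (x{\Rightarrow} y){\Rightarrow}\neg(x{\Rightarrow}\neg y)$, $1\leq (x{\Rightarrow}\neg y){\Rightarrow}\neg(x{\Rightarrow} y)$, and connexive if moreover some member of $\mathsf V(\mathbf L)$ has elements $x,y$ with $x{\Rightarrow} y\neq y{\Rightarrow} x$. -}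

module Defs where

open import Data.Nat using (ℕ)
open import Data.Product using (_×_; Σ; Σ-syntax)
open import Data.Sum using (_⊎_)
open import Level using (Level)
open import Relation.Binary.PropositionalEquality using (_≡_)
open import Relation.Nullary using (¬_)

infixr 5 _⟶_
infixl 6 _∧ᶠ_ _∨ᶠ_ _·ᶠ_

data Fm : Set where
  var   : ℕ → Fm
  _∧ᶠ_  : Fm → Fm → Fm
  _∨ᶠ_  : Fm → Fm → Fm
  _·ᶠ_  : Fm → Fm → Fm
  _⟶_   : Fm → Fm → Fm
  𝟘 𝟙   : Fm

∼ : Fm → Fm
∼ φ = φ ⟶ 𝟘

data Arrow : Set where
  ⇒∧ ⇒∘ : Arrow

imp : Arrow → Fm → Fm → Fm
imp ⇒∧ φ ψ = (φ ⟶ ψ) ∧ᶠ (ψ ⟶ ∼ (∼ φ))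
imp ⇒∘ φ ψ = (φ ⟶ ψ) ·ᶠ (ψ ⟶ ∼ (∼ φ))

record FLe : Set₁ where
  infixl 6 _∧_ _∨_ _·_
  infixr 5 _⇾_
  infix 4 _≤_
  field
    Carrier : Set
    _∧_ _∨_ _·_ _⇾_ : Carrier → Carrier → Carrier
    zero one : Carrier

  _≤_ : Carrier → Carrier → Set
  x ≤ y = x ∧ y ≡ x

  field
    ∧-assoc : ∀ x y z → (x ∧ y) ∧ z ≡ x ∧ (y ∧ z)
    ∨-assoc : ∀ x y z → (x ∨ y) ∨ z ≡ x ∨ (y ∨ z)
    ∧-comm  : ∀ x y → x ∧ y ≡ y ∧ x
    ∨-comm  : ∀ x y → x ∨ y ≡ y ∨ x
    ∧-absorb : ∀ x y → x ∧ (x ∨ y) ≡ x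
    ∨-absorb : ∀ x y → x ∨ (x ∧ y) ≡ x
    ·-assoc : ∀ x y z → (x · y) · z ≡ x · (y · z)
    ·-comm  : ∀ x y → x · y ≡ y · x
    ·-identity : ∀ x → one · x ≡ x
    residuation₁ : ∀ x y z → x · y ≤ z → x ≤ y ⇾ z
    residuation₂ : ∀ x y z → x ≤ y ⇾ z → x · y ≤ z

  neg : Carrier → Carrier
  neg x = x ⇾ zero

open FLe public using (Carrier)

⟦_⟧ : Fm → (A : FLe) → (ℕ → FLe.Carrier A) → FLe.Carrier A
⟦ var n ⟧ A v = v n
⟦ φ ∧ᶠ ψ ⟧ A v = FLe._∧_ A (⟦ φ ⟧ A v) (⟦ ψ ⟧ A v)
⟦ φ ∨ᶠ ψ ⟧ A v = FLe._∨_ A (⟦ φ ⟧ A v) (⟦ ψ ⟧ A v)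
⟦ φ ·ᶠ ψ ⟧ A v = FLe._·_ A (⟦ φ ⟧ A v) (⟦ ψ ⟧ A v)
⟦ φ ⟶ ψ ⟧ A v = FLe._⇾_ A (⟦ φ ⟧ A v) (⟦ ψ ⟧ A v)
⟦ 𝟘 ⟧ A v = FLe.zero A
⟦ 𝟙 ⟧ A v = FLe.one A

arr : Arrow → (A : FLe) → Carrier A → Carrier A → Carrier A
arr ⇒∧ A x y = (x ⇾ y) ∧ (y ⇾ neg (neg x)) where open FLe A
arr ⇒∘ A x y = (x ⇾ y) · (y ⇾ neg (neg x)) where open FLe A

Valid : FLe → Fm → Set
Valid A φ = ∀ (v : ℕ → Carrier A) → FLe._≤_ A (FLe.one A) (⟦ φ ⟧ A v)

Logic : Set₂
Logic = Fm → Set₁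

Models : Logic → FLe → Set₁
Models L A = ∀ φ → L φ → Valid A φ

-- consequence: φ is a theorem of the axiomatic extension of FL_e by L
Cn : Logic → Fm → Set₁
Cn L φ = ∀ (A : FLe) → Models L A → Valid A φ

-- L is a substructural logic (an axiomatic extension of FL_e): L is closed
-- under FL_e-consequence (⊢_L φ iff V(L) ⊨ 1 ≤ φ).
IsSubstructural : Logic → Set₁
IsSubstructural L = ∀ φ → Cn L φ → L φ

Integral : FLe → Set
Integral A = (∀ x → x ≤ one) × (∀ x → zero ≤ x) where open FLe A

IsHeyting : FLe → Set
IsHeyting A = Integral A × (∀ x y → x · y ≡ x ∧ y) where open FLe A

IsBoolean : FLe → Set
IsBoolean A = IsHeyting A × (∀ x → neg (neg x) ≡ x) where open FLe A

FLew : Logic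
FLew φ = ∀ (A : FLe) → Integral A → Valid A φ

IPL : Logic
IPL φ = ∀ (A : FLe) → IsHeyting A → Valid A φ

CPL : Logic
CPL φ = ∀ (A : FLe) → IsBoolean A → Valid A φ

_⊆ᴸ_ : ∀ {a b} → (Fm → Set a) → (Fm → Set b) → Set _
P ⊆ᴸ Q = ∀ φ → P φ → Q φ

Glivenko : Logic → Set₁
Glivenko K = ∀ φ → (CPL φ → K (∼ (∼ φ))) × (K (∼ (∼ φ)) → CPL φ)

G-FLe-CPL : Fm → Set₂
G-FLe-CPL φ = ∀ (K : Logic) → IsSubstructural K → Glivenko K → K φ

G-FLew-CPL : Fm → Set₂
G-FLew-CPL φ = ∀ (K : Logic) → IsSubstructural K →
               G-FLe-CPL ⊆ᴸ K → FLew ⊆ᴸ K → K φ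

ProtoConnexive : Logic → Arrow → Set₁
ProtoConnexive L c = ∀ (A : FLe) → Models L A → ∀ (x y : Carrier A) →
    let open FLe A in
      (one ≤ neg (arr c A x (neg x)))
    × (one ≤ neg (arr c A (neg x) x))
    × (one ≤ arr c A (arr c A x y) (neg (arr c A x (neg y))))
    × (one ≤ arr c A (arr c A x (neg y)) (neg (arr c A x y)))

Connexive : Logic → Arrow → Set₁
Connexive L c = ProtoConnexive L c ×
  Σ[ A ∈ FLe ] (Models L A × Σ[ x ∈ Carrier A ] Σ[ y ∈ Carrier A ]
     ¬ (arr c A x y ≡ arr c A y x))

AristotleThesis : Logic → Arrow → Set₁
AristotleThesis L c = (∀ φ → L (∼ (imp c φ (∼ φ))))
                    ⊎ (∀ φ → L (∼ (imp c (∼ φ) φ)))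

{-# OPTIONS --safe #-}

-- In an integral FLe-algebra either of Aristotle's theses, applied to a ∧ ¬a, forces
-- x ∧ ¬x ≤ 0. In integral algebras with x ∧ ¬x ≤ 0 an element whose cube is below 0
-- is itself below 0, so negation cannot distinguish products from meets. This
-- validates all four connexive laws, and it makes double negation a homomorphism onto
-- the Boolean algebra of regular elements, which gives the Glivenko property and hence
-- G_FLew(CPL) ⊆ L. The three-element Heyting chain, a model of every L ⊆ IPL, shows
-- that ⇒ is not symmetric. Conversely G_FLew(CPL) proves Aristotle's thesis, since CPL
-- does and ¬¬¬φ → ¬φ holds.

module Submission where

open import Defs
open import Algebra.Bundles using (CommutativeSemigroup)
import Algebra.Properties.CommutativeSemigroup as CommutativeSemigroupProperties
open import Axiom.UniquenessOfIdentityProofs.WithK using (uip)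
open import Data.Bool using (if_then_else_)
open import Data.Fin using (Fin; _≤?_)
open import Data.Fin.Patterns using (0F; 1F; 2F)
open import Data.Fin.Properties using (all?; _≟_)
open import Data.Product using (_×_; _,_; proj₁; proj₂; Σ)
open import Data.Sum using (inj₁; inj₂)
open import Function.Base using (_∘_)
open import Function.Bundles using (_⇔_; mk⇔)
open import Relation.Nullary.Decidable using (Dec; does; from-yes; _→-dec_)
open import Relation.Binary.Bundles using (Poset)
import Relation.Binary.Reasoning.PartialOrder as PartialOrderReasoning
open import Relation.Binary.PropositionalEquality
  using (_≡_; refl; sym; trans; cong; cong₂; subst; isEquivalence; _≢_; module ≡-Reasoning)

module FLeProperties (A : FLe) where
  open FLe A hiding (Carrier)

  ∧-idem : ∀ x → x ∧ x ≡ x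
  ∧-idem x = trans (cong (x ∧_) (sym (∨-absorb x x))) (∧-absorb x (x ∧ x))

  ≤-refl : ∀ {x} → x ≤ x
  ≤-refl = ∧-idem _

  ≤-reflexive : ∀ {x y} → x ≡ y → x ≤ y
  ≤-reflexive refl = ≤-refl

  ≤-trans : ∀ {x y z} → x ≤ y → y ≤ z → x ≤ z
  ≤-trans {x} {y} {z} x≤y y≤z =
    trans (cong (_∧ z) (sym x≤y)) (trans (∧-assoc x y z) (trans (cong (x ∧_) y≤z) x≤y))

  ≤-antisym : ∀ {x y} → x ≤ y → y ≤ x → x ≡ y
  ≤-antisym {x} {y} x≤y y≤x = trans (sym x≤y) (trans (∧-comm x y) y≤x)

  ≤-poset : Poset _ _ _
  ≤-poset = record
    { Carrier = Carrier A
    ; _≈_ = _≡_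
    ; _≤_ = _≤_
    ; isPartialOrder = record
      { isPreorder = record
        { isEquivalence = isEquivalence ; reflexive = ≤-reflexive ; trans = ≤-trans }
      ; antisym = ≤-antisym
      }
    }

  module ≤-Reasoning = PartialOrderReasoning ≤-poset

  x∧y≤x : ∀ {x y} → x ∧ y ≤ x
  x∧y≤x {x} {y} = trans (∧-comm (x ∧ y) x)
    (trans (sym (∧-assoc x x y)) (cong (_∧ y) (∧-idem x)))

  x∧y≤y : ∀ {x y} → x ∧ y ≤ y
  x∧y≤y {x} {y} = trans (∧-assoc x y y) (cong (x ∧_) (∧-idem y))

  ∧-greatest : ∀ {x y z} → z ≤ x → z ≤ y → z ≤ x ∧ y
  ∧-greatest {x} {y} {z} z≤x z≤y = trans (sym (∧-assoc z x y)) (trans (cong (_∧ y) z≤x) z≤y)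

  x≤x∨y : ∀ {x y} → x ≤ x ∨ y
  x≤x∨y {x} {y} = ∧-absorb x y

  y≤x∨y : ∀ {x y} → y ≤ x ∨ y
  y≤x∨y {x} {y} = subst (y ≤_) (∨-comm y x) x≤x∨y

  ∨-least : ∀ {x y z} → x ≤ z → y ≤ z → x ∨ y ≤ z
  ∨-least {x} {y} {z} x≤z y≤z =
    join⇒≤ (trans (∨-assoc x y z) (trans (cong (x ∨_) (≤⇒join y≤z)) (≤⇒join x≤z)))
    where
      ≤⇒join : ∀ {a b} → a ≤ b → a ∨ b ≡ b
      ≤⇒join {a} {b} a≤b = trans (cong (_∨ b) (sym a≤b))
        (trans (∨-comm (a ∧ b) b) (trans (cong (b ∨_) (∧-comm a b)) (∨-absorb b a)))
      join⇒≤ : ∀ {a b} → a ∨ b ≡ b → a ≤ b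
      join⇒≤ {a} {b} a∨b≡b = trans (cong (a ∧_) (sym a∨b≡b)) (∧-absorb a b)

  ·-commutativeSemigroup : CommutativeSemigroup _ _
  ·-commutativeSemigroup = record
    { isCommutativeSemigroup = record
      { isSemigroup = record
        { isMagma = record { isEquivalence = isEquivalence ; ∙-cong = cong₂ _·_ }
        ; assoc = ·-assoc
        }
      ; comm = ·-comm
      }
    }

  open CommutativeSemigroupProperties ·-commutativeSemigroup
    using (xy∙z≈xz∙y; xy∙z≈zy∙x)

  ·-identityʳ : ∀ x → x · one ≡ x
  ·-identityʳ x = trans (·-comm x one) (·-identity x)

  curry : ∀ {x y z} → x · y ≤ z → x ≤ y ⇾ z
  curry = residuation₁ _ _ _

  uncurry : ∀ {x y z} → x ≤ y ⇾ z → x · y ≤ z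
  uncurry = residuation₂ _ _ _

  modus-ponens : ∀ {x y} → (x ⇾ y) · x ≤ y
  modus-ponens = uncurry ≤-refl

  ·-swap-≤ : ∀ {x y z} → x · y ≤ z → y · x ≤ z
  ·-swap-≤ {x} {y} = subst (_≤ _) (·-comm x y)

  ·-monoˡ : ∀ {x y z} → x ≤ y → x · z ≤ y · z
  ·-monoˡ x≤y = uncurry (≤-trans x≤y (curry ≤-refl))

  ·-monoʳ : ∀ {x y z} → x ≤ y → z · x ≤ z · y
  ·-monoʳ x≤y = ·-swap-≤ (≤-trans (·-monoˡ x≤y) (≤-reflexive (·-comm _ _)))

  ·-mono : ∀ {x y u v} → x ≤ y → u ≤ v → x · u ≤ y · v
  ·-mono x≤y u≤v = ≤-trans (·-monoˡ x≤y) (·-monoʳ u≤v)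

  one≤⇾ : ∀ {x y} → x ≤ y → one ≤ x ⇾ y
  one≤⇾ {x} {y} x≤y = curry (subst (_≤ y) (sym (·-identity x)) x≤y)

  one≤⇾⇒≤ : ∀ {x y} → one ≤ x ⇾ y → x ≤ y
  one≤⇾⇒≤ {x} {y} one≤x⇾y = subst (_≤ y) (·-identity x) (uncurry one≤x⇾y)

  x·neg-x≤zero : ∀ {x} → x · neg x ≤ zero
  x·neg-x≤zero = ·-swap-≤ modus-ponens

  neg-antitone : ∀ {x y} → x ≤ y → neg y ≤ neg x
  neg-antitone x≤y = curry (≤-trans (·-monoʳ x≤y) modus-ponens)

  contraposition : ∀ {x y} → (x ⇾ neg y) · y ≤ neg x
  contraposition {x} {y} = curry (begin
    ((x ⇾ neg y) · y) · x  ≡⟨ xy∙z≈xz∙y _ y x ⟩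
    ((x ⇾ neg y) · x) · y  ≤⟨ ·-monoˡ modus-ponens ⟩
    neg y · y              ≤⟨ modus-ponens ⟩
    zero                   ∎)
    where open ≤-Reasoning

  γ : Carrier A → Carrier A
  γ x = neg (neg x)

  x≤γx : ∀ {x} → x ≤ γ x
  x≤γx = curry x·neg-x≤zero

  γ-mono : ∀ {x y} → x ≤ y → γ x ≤ γ y
  γ-mono x≤y = neg-antitone (neg-antitone x≤y)

  neg-γ : ∀ {x} → neg (γ x) ≡ neg x
  neg-γ = ≤-antisym (neg-antitone x≤γx) x≤γx

  γ-idem : ∀ {x} → γ (γ x) ≡ γ x
  γ-idem = neg-γ

  γ·γ≤γ· : ∀ {x y} → γ x · γ y ≤ γ (x · y)
  γ·γ≤γ· {x} {y} = curry (begin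
    (γ x · γ y) · n  ≡⟨ xy∙z≈zy∙x (γ x) (γ y) n ⟩
    (n · γ y) · γ x  ≤⟨ ·-monoˡ n·γy≤neg-x ⟩
    neg x · γ x      ≤⟨ x·neg-x≤zero ⟩
    zero             ∎)
    where
      open ≤-Reasoning
      n = neg (x · y)
      n·x≤neg-y : n · x ≤ neg y
      n·x≤neg-y = curry (≤-trans (≤-reflexive (·-assoc n x y)) modus-ponens)
      n·γy≤neg-x : n · γ y ≤ neg x
      n·γy≤neg-x = curry (≤-trans (≤-reflexive (xy∙z≈xz∙y n (γ y) x))
                                  (≤-trans (·-monoˡ n·x≤neg-y) x·neg-x≤zero))

  γ⇾≤γ⇾γ : ∀ {x y} → γ (x ⇾ y) ≤ γ x ⇾ γ y
  γ⇾≤γ⇾γ = curry (≤-trans γ·γ≤γ· (γ-mono modus-ponens))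

  γ-⇾neg : ∀ {x y} → γ (x ⇾ neg y) ≡ x ⇾ neg y
  γ-⇾neg {x} {y} = ≤-antisym (curry (curry (begin
      (γ (x ⇾ neg y) · x) · y  ≡⟨ ·-assoc _ x y ⟩
      γ (x ⇾ neg y) · (x · y)  ≤⟨ ·-monoˡ (≤-trans (γ-mono ⇾neg≤neg·) (≤-reflexive neg-γ)) ⟩
      neg (x · y) · (x · y)    ≤⟨ modus-ponens ⟩
      zero                     ∎))) x≤γx
    where
      open ≤-Reasoning
      ⇾neg≤neg· : x ⇾ neg y ≤ neg (x · y)
      ⇾neg≤neg· = curry (≤-trans (≤-reflexive (sym (·-assoc _ x y)))
                                 (≤-trans (·-monoˡ modus-ponens) modus-ponens))

  γ-∨ : ∀ {x y} → γ (γ x ∨ γ y) ≡ γ (x ∨ y)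
  γ-∨ = ≤-antisym
    (≤-trans (γ-mono (∨-least (γ-mono x≤x∨y) (γ-mono y≤x∨y))) (≤-reflexive γ-idem))
    (γ-mono (∨-least (≤-trans x≤γx x≤x∨y) (≤-trans x≤γx y≤x∨y)))

  γ-zero : γ zero ≡ zero
  γ-zero = ≤-antisym
    (≤-trans (neg-antitone (one≤⇾ ≤-refl))
             (≤-trans (≤-reflexive (sym (·-identityʳ _))) modus-ponens))
    x≤γx

Noncontradictory : FLe → Set
Noncontradictory A = ∀ x → x ∧ neg x ≤ zero
  where open FLe A

Aristotle₁ : FLe → Arrow → Set
Aristotle₁ A c = ∀ x → one ≤ neg (arr c A x (neg x))
  where open FLe A

Aristotle₂ : FLe → Arrow → Set
Aristotle₂ A c = ∀ x → one ≤ neg (arr c A (neg x) x)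
  where open FLe A

heyting⇒noncontradictory : ∀ A → IsHeyting A → Noncontradictory A
heyting⇒noncontradictory A (_ , ·≡∧) x = subst (_≤ zero) (·≡∧ x (neg x)) x·neg-x≤zero
  where
    open FLe A
    open FLeProperties A

module IntegralProperties (A : FLe) (integral : Integral A) where
  open FLe A hiding (Carrier)
  open FLeProperties A

  x≤one : ∀ {x} → x ≤ one
  x≤one = proj₁ integral _

  zero≤x : ∀ {x} → zero ≤ x
  zero≤x = proj₂ integral _

  x·y≤x : ∀ {x y} → x · y ≤ x
  x·y≤x {x} = ≤-trans (·-monoʳ x≤one) (≤-reflexive (·-identityʳ x))

  x·y≤y : ∀ {x y} → x · y ≤ y
  x·y≤y = ·-swap-≤ x·y≤x

  x·y≤x∧y : ∀ {x y} → x · y ≤ x ∧ y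
  x·y≤x∧y = ∧-greatest x·y≤x x·y≤y

  y≤x⇾y : ∀ {x y} → y ≤ x ⇾ y
  y≤x⇾y = curry x·y≤x

  neg-x≤x⇾y : ∀ {x y} → neg x ≤ x ⇾ y
  neg-x≤x⇾y = curry (≤-trans modus-ponens zero≤x)

  γ-one : γ one ≡ one
  γ-one = ≤-antisym x≤one x≤γx

  arr≤arr∧ : ∀ c {x y} → arr c A x y ≤ arr ⇒∧ A x y
  arr≤arr∧ ⇒∧ = ≤-refl
  arr≤arr∧ ⇒∘ = x·y≤x∧y

  arr∘≤arr : ∀ c {x y} → arr ⇒∘ A x y ≤ arr c A x y
  arr∘≤arr ⇒∧ = x·y≤x∧y
  arr∘≤arr ⇒∘ = ≤-refl

  ≤arr : ∀ c {u v x y} → u ≤ x ⇾ y → v ≤ y ⇾ γ x → u · v ≤ arr c A x y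
  ≤arr c u≤ v≤ = ≤-trans (·-mono u≤ v≤) (arr∘≤arr c)

  one≤arr-neg : ∀ c {x y} → x · y ≤ zero → neg y · neg x ≤ zero → one ≤ arr c A x (neg y)
  one≤arr-neg c xy≤zero ¬y¬x≤zero =
    ≤-trans (≤-reflexive (sym (·-identity one)))
            (≤arr c (one≤⇾ (curry xy≤zero)) (one≤⇾ (curry ¬y¬x≤zero)))

  ≤arr∧-both : ∀ {u x y} → u ≤ x → u ≤ y → u ≤ arr ⇒∧ A x y
  ≤arr∧-both u≤x u≤y = ∧-greatest (≤-trans u≤y y≤x⇾y) (≤-trans (≤-trans u≤x x≤γx) y≤x⇾y)

  ≤arr∧-neither : ∀ {u x y} → u ≤ neg x → u ≤ neg y → u ≤ arr ⇒∧ A x y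
  ≤arr∧-neither u≤¬x u≤¬y = ∧-greatest (≤-trans u≤¬x neg-x≤x⇾y) (≤-trans u≤¬y neg-x≤x⇾y)

  aristotle₁⇒noncontradictory : ∀ c → Aristotle₁ A c → Noncontradictory A
  aristotle₁⇒noncontradictory c thesis a =
    subst (_≤ zero) (·-identity y) (refuted (one≤⇾ (curry y·y≤zero)) (≤-trans x≤γx y≤x⇾y))
    where
      y = a ∧ neg a
      refuted : ∀ {u v x} → u ≤ x ⇾ neg x → v ≤ neg x ⇾ γ x → u · v ≤ zero
      refuted u≤ v≤ = ≤-trans (≤arr c u≤ v≤) (one≤⇾⇒≤ (thesis _))
      y·y≤zero : y · y ≤ zero
      y·y≤zero = refuted (curry (≤-trans x·y≤x x∧y≤y)) (≤-trans (≤-trans x∧y≤x x≤γx) y≤x⇾y)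

  aristotle₂⇒noncontradictory : ∀ c → Aristotle₂ A c → Noncontradictory A
  aristotle₂⇒noncontradictory c thesis a =
    subst (_≤ zero) (·-identityʳ y) (refuted y≤x⇾y (one≤⇾ (≤-trans (curry y·y≤zero) x≤γx)))
    where
      y = a ∧ neg a
      refuted : ∀ {u v x} → u ≤ neg x ⇾ x → v ≤ x ⇾ γ (neg x) → u · v ≤ zero
      refuted u≤ v≤ = ≤-trans (≤arr c u≤ v≤) (one≤⇾⇒≤ (thesis _))
      y·y≤zero : y · y ≤ zero
      y·y≤zero = refuted (curry (≤-trans x·y≤x x∧y≤x)) (≤-trans (≤-trans x∧y≤y x≤γx) y≤x⇾y)

module NoncontradictoryProperties (A : FLe) (integral : Integral A) (nc : Noncontradictory A) where
  open FLe A hiding (Carrier)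
  open FLeProperties A
  open IntegralProperties A integral

  noncontradiction : ∀ {w x} → w ≤ x → w ≤ neg x → w ≤ zero
  noncontradiction w≤x w≤¬x = ≤-trans (∧-greatest w≤x w≤¬x) (nc _)

  reductio : ∀ {w x y} → w · x ≤ y → w · x ≤ neg y → w ≤ neg x
  reductio wx≤y wx≤¬y = curry (noncontradiction wx≤y wx≤¬y)

  by-cases : ∀ {w x} → w ∧ x ≤ zero → w ∧ neg x ≤ zero → w ≤ zero
  by-cases w∧x≤zero w∧¬x≤zero =
    noncontradiction (curry (≤-trans x·y≤x∧y w∧x≤zero)) (curry (≤-trans x·y≤x∧y w∧¬x≤zero))

  cube≤zero⇒≤zero : ∀ {w} → w · (w · w) ≤ zero → w ≤ zero
  cube≤zero⇒≤zero {w} w³≤zero = noncontradiction ≤-refl (curry w²≤zero)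
    where
      w²≤zero : w · w ≤ zero
      w²≤zero = noncontradiction x·y≤x (curry (≤-trans (≤-reflexive (·-assoc w w w)) w³≤zero))

  contraction : ∀ {x y} → x · (y · y) ≤ zero → x · y ≤ zero
  contraction {x} {y} xyy≤zero = ≤-trans x·y≤x∧y (cube≤zero⇒≤zero
    (≤-trans (·-mono x∧y≤x (·-mono x∧y≤y x∧y≤y)) xyy≤zero))

  square≤neg⇒≤neg : ∀ {w x} → w · w ≤ neg x → w ≤ neg x
  square≤neg⇒≤neg w·w≤¬x = curry (·-swap-≤ (contraction (·-swap-≤ (uncurry w·w≤¬x))))

  neg-·≤neg-∧ : ∀ {x y} → neg (x · y) ≤ neg (x ∧ y)
  neg-·≤neg-∧ = curry (contraction (≤-trans (·-monoʳ (·-mono x∧y≤x x∧y≤y)) modus-ponens))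

  neg-arr≤neg-arr∧ : ∀ c {x y} → neg (arr c A x y) ≤ neg (arr ⇒∧ A x y)
  neg-arr≤neg-arr∧ ⇒∧ = ≤-refl
  neg-arr≤neg-arr∧ ⇒∘ = neg-·≤neg-∧

  aristotle₁ : ∀ c → Aristotle₁ A c
  aristotle₁ c x = one≤⇾ (≤-trans (arr≤arr∧ c) (noncontradiction m≤¬x m≤¬¬x))
    where
      m = arr ⇒∧ A x (neg x)
      m≤¬x : m ≤ neg x
      m≤¬x = reductio x·y≤y (≤-trans (·-monoˡ x∧y≤x) modus-ponens)
      m≤¬¬x : m ≤ neg (neg x)
      m≤¬¬x = reductio x·y≤y (≤-trans (·-monoˡ x∧y≤y) modus-ponens)

  aristotle₂ : ∀ c → Aristotle₂ A c
  aristotle₂ c x = one≤⇾ (≤-trans (arr≤arr∧ c) (noncontradiction m≤¬x m≤¬¬x))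
    where
      m = arr ⇒∧ A (neg x) x
      m≤¬x : m ≤ neg x
      m≤¬x = reductio (≤-trans x·y≤y x≤γx) (≤-trans (·-monoˡ x∧y≤y) modus-ponens)
      m≤¬¬x : m ≤ neg (neg x)
      m≤¬¬x = reductio x·y≤y (≤-trans (≤-trans (·-monoˡ x∧y≤x) modus-ponens) x≤γx)

  arr∧-disjoint : ∀ {x y} → arr ⇒∧ A x y ∧ arr ⇒∧ A x (neg y) ≤ zero
  arr∧-disjoint {x} {y} = noncontradiction w≤¬x w≤¬¬x
    where
      w = arr ⇒∧ A x y ∧ arr ⇒∧ A x (neg y)
      w≤¬x : w ≤ neg x
      w≤¬x = reductio (≤-trans (·-monoˡ (≤-trans x∧y≤x x∧y≤x)) modus-ponens)
                      (≤-trans (·-monoˡ (≤-trans x∧y≤y x∧y≤x)) modus-ponens)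
      w≤¬¬x : w ≤ neg (neg x)
      w≤¬¬x = reductio (≤-trans (·-monoˡ (≤-trans x∧y≤x x∧y≤y)) contraposition)
                       (≤-trans (·-monoˡ (≤-trans x∧y≤y x∧y≤y)) contraposition)

  -- Each of x ∧ y, x ∧ ¬y, ¬x ∧ y, ¬x ∧ ¬y lies below x ⇒∧ y or below x ⇒∧ ¬y.
  neg-arr∧-disjoint : ∀ {x y} → neg (arr ⇒∧ A x y) ∧ neg (arr ⇒∧ A x (neg y)) ≤ zero
  neg-arr∧-disjoint {x} {y} = by-cases (by-cases x-y x-¬y) (by-cases ¬x-y ¬x-¬y)
    where
      w = neg (arr ⇒∧ A x y) ∧ neg (arr ⇒∧ A x (neg y))
      w₁ : ∀ {u v} → (w ∧ u) ∧ v ≤ neg (arr ⇒∧ A x y)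
      w₁ = ≤-trans x∧y≤x (≤-trans x∧y≤x x∧y≤x)
      w₂ : ∀ {u v} → (w ∧ u) ∧ v ≤ neg (arr ⇒∧ A x (neg y))
      w₂ = ≤-trans x∧y≤x (≤-trans x∧y≤x x∧y≤y)
      u : ∀ {u v} → (w ∧ u) ∧ v ≤ u
      u = ≤-trans x∧y≤x x∧y≤y
      x-y : (w ∧ x) ∧ y ≤ zero
      x-y = noncontradiction (≤arr∧-both u x∧y≤y) w₁
      x-¬y : (w ∧ x) ∧ neg y ≤ zero
      x-¬y = noncontradiction (≤arr∧-both u x∧y≤y) w₂
      ¬x-y : (w ∧ neg x) ∧ y ≤ zero
      ¬x-y = noncontradiction (≤arr∧-neither u (≤-trans x∧y≤y x≤γx)) w₂
      ¬x-¬y : (w ∧ neg x) ∧ neg y ≤ zero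
      ¬x-¬y = noncontradiction (≤arr∧-neither u x∧y≤y) w₁

  arr-disjoint : ∀ c {x y} → arr c A x y · arr c A x (neg y) ≤ zero
  arr-disjoint c = ≤-trans (·-mono (arr≤arr∧ c) (arr≤arr∧ c)) (≤-trans x·y≤x∧y arr∧-disjoint)

  neg-arr-disjoint : ∀ c {x y} → neg (arr c A x y) · neg (arr c A x (neg y)) ≤ zero
  neg-arr-disjoint c =
    ≤-trans (·-mono (neg-arr≤neg-arr∧ c) (neg-arr≤neg-arr∧ c)) (≤-trans x·y≤x∧y neg-arr∧-disjoint)

  boethius₁ : ∀ c x y → one ≤ arr c A (arr c A x y) (neg (arr c A x (neg y)))
  boethius₁ c x y = one≤arr-neg c (arr-disjoint c) (·-swap-≤ (neg-arr-disjoint c))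

  boethius₂ : ∀ c x y → one ≤ arr c A (arr c A x (neg y)) (neg (arr c A x y))
  boethius₂ c x y = one≤arr-neg c (·-swap-≤ (arr-disjoint c)) (neg-arr-disjoint c)

  γ∧γ≤γ· : ∀ {x y} → γ x ∧ γ y ≤ γ (x · y)
  γ∧γ≤γ· = square≤neg⇒≤neg (≤-trans (·-mono x∧y≤x x∧y≤y) γ·γ≤γ·)

  γ-∧ : ∀ {x y} → γ (x ∧ y) ≡ γ x ∧ γ y
  γ-∧ = ≤-antisym (∧-greatest (γ-mono x∧y≤x) (γ-mono x∧y≤y)) (≤-trans γ∧γ≤γ· (γ-mono x·y≤x∧y))

  γ-· : ∀ {x y} → γ (x · y) ≡ γ x ∧ γ y
  γ-· = ≤-antisym (∧-greatest (γ-mono x·y≤x) (γ-mono x·y≤y)) γ∧γ≤γ·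

  γ-⇾ : ∀ {x y} → γ (x ⇾ y) ≡ γ x ⇾ γ y
  γ-⇾ {x} {y} = ≤-antisym γ⇾≤γ⇾γ (curry (contraction (begin
      t · (s · s)          ≤⟨ ·-monoʳ (·-mono s≤γx s≤¬y) ⟩
      t · (γ x · neg y)    ≡⟨ ·-assoc t (γ x) (neg y) ⟨
      (t · γ x) · neg y    ≤⟨ ·-monoˡ modus-ponens ⟩
      γ y · neg y          ≤⟨ modus-ponens ⟩
      zero                 ∎)))
    where
      open ≤-Reasoning
      t = γ x ⇾ γ y
      s = neg (x ⇾ y)
      s≤γx : s ≤ γ x
      s≤γx = curry (≤-trans (·-monoʳ neg-x≤x⇾y) modus-ponens)
      s≤¬y : s ≤ neg y
      s≤¬y = curry (≤-trans (·-monoʳ y≤x⇾y) modus-ponens)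

module RegularElements (A : FLe) (integral : Integral A) (nc : Noncontradictory A) where
  open FLe A hiding (Carrier)
  open FLeProperties A
  open IntegralProperties A integral
  open NoncontradictoryProperties A integral nc

  Regular : Set
  Regular = Σ (Carrier A) (λ x → γ x ≡ x)

  regular-≡ : ∀ {x y} {γx≡x : γ x ≡ x} {γy≡y : γ y ≡ y} →
              x ≡ y → _≡_ {A = Regular} (x , γx≡x) (y , γy≡y)
  regular-≡ {x} {γx≡x = γx≡x} {γy≡y} refl = cong (x ,_) (uip γx≡x γy≡y)

  γᴿ : Carrier A → Regular
  γᴿ x = γ x , γ-idem

  _∧ᴿ_ _∨ᴿ_ _⇾ᴿ_ : Regular → Regular → Regular
  (x , γx≡x) ∧ᴿ (y , γy≡y) = x ∧ y , trans γ-∧ (cong₂ _∧_ γx≡x γy≡y)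
  (x , _) ∨ᴿ (y , _) = γᴿ (x ∨ y)
  (x , _) ⇾ᴿ (y , γy≡y) = x ⇾ y , subst (λ z → γ (x ⇾ z) ≡ x ⇾ z) γy≡y γ-⇾neg

  ∨ᴿ-assoc : ∀ x y z → (x ∨ᴿ y) ∨ᴿ z ≡ x ∨ᴿ (y ∨ᴿ z)
  ∨ᴿ-assoc (x , γx≡x) (y , _) (z , γz≡z) = regular-≡ (begin
    γ (γ (x ∨ y) ∨ z)      ≡⟨ cong (λ w → γ (γ (x ∨ y) ∨ w)) γz≡z ⟨
    γ (γ (x ∨ y) ∨ γ z)    ≡⟨ γ-∨ ⟩
    γ ((x ∨ y) ∨ z)        ≡⟨ cong γ (∨-assoc x y z) ⟩
    γ (x ∨ (y ∨ z))        ≡⟨ γ-∨ ⟨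
    γ (γ x ∨ γ (y ∨ z))    ≡⟨ cong (λ w → γ (w ∨ γ (y ∨ z))) γx≡x ⟩
    γ (x ∨ γ (y ∨ z))      ∎)
    where open ≡-Reasoning

  ∧ᴿ-residual : ∀ x y z → x ∧ᴿ (y ⇾ᴿ z) ≡ x → (x ∧ᴿ y) ∧ᴿ z ≡ x ∧ᴿ y
  ∧ᴿ-residual (x , _) (y , _) (z , γz≡z) x≤y⇾z = regular-≡ (subst (x ∧ y ≤_) γz≡z
    (square≤neg⇒≤neg (≤-trans (·-mono x∧y≤x x∧y≤y)
                              (≤-trans (uncurry (cong proj₁ x≤y⇾z)) (≤-reflexive (sym γz≡z))))))

  boolean : FLe
  boolean = record
    { Carrier = Regular
    ; _∧_ = _∧ᴿ_ ; _∨_ = _∨ᴿ_ ; _·_ = _∧ᴿ_ ; _⇾_ = _⇾ᴿ_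
    ; zero = zero , γ-zero ; one = one , γ-one
    ; ∧-assoc = λ { (x , _) (y , _) (z , _) → regular-≡ (∧-assoc x y z) }
    ; ∨-assoc = ∨ᴿ-assoc
    ; ∧-comm = λ { (x , _) (y , _) → regular-≡ (∧-comm x y) }
    ; ∨-comm = λ { (x , _) (y , _) → regular-≡ (cong γ (∨-comm x y)) }
    ; ∧-absorb = λ { (x , _) (y , _) → regular-≡ (≤-trans x≤x∨y x≤γx) }
    ; ∨-absorb = λ { (x , γx≡x) (y , _) → regular-≡ (trans (cong γ (∨-absorb x y)) γx≡x) }
    ; ·-assoc = λ { (x , _) (y , _) (z , _) → regular-≡ (∧-assoc x y z) }
    ; ·-comm = λ { (x , _) (y , _) → regular-≡ (∧-comm x y) }
    ; ·-identity = λ { (x , _) → regular-≡ (trans (∧-comm one x) x≤one) }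
    ; residuation₁ = λ { (x , _) (y , _) (z , _) x∧y≤z →
        regular-≡ (curry (≤-trans x·y≤x∧y (cong proj₁ x∧y≤z))) }
    ; residuation₂ = ∧ᴿ-residual
    }

  boolean-isBoolean : IsBoolean boolean
  boolean-isBoolean =
    ( ( (λ { (x , _) → regular-≡ x≤one }) , (λ { (x , _) → regular-≡ zero≤x }) )
    , (λ _ _ → refl) )
    , λ { (x , γx≡x) → regular-≡ γx≡x }

  ⟦⟧-γᴿ : ∀ φ v → proj₁ (⟦ φ ⟧ boolean (λ n → γᴿ (v n))) ≡ γ (⟦ φ ⟧ A v)
  ⟦⟧-γᴿ (var n) v = refl
  ⟦⟧-γᴿ (φ ∧ᶠ ψ) v = trans (cong₂ _∧_ (⟦⟧-γᴿ φ v) (⟦⟧-γᴿ ψ v)) (sym γ-∧)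
  ⟦⟧-γᴿ (φ ∨ᶠ ψ) v = trans (cong γ (cong₂ _∨_ (⟦⟧-γᴿ φ v) (⟦⟧-γᴿ ψ v))) γ-∨
  ⟦⟧-γᴿ (φ ·ᶠ ψ) v = trans (cong₂ _∧_ (⟦⟧-γᴿ φ v) (⟦⟧-γᴿ ψ v)) (sym γ-·)
  ⟦⟧-γᴿ (φ ⟶ ψ) v = trans (cong₂ _⇾_ (⟦⟧-γᴿ φ v) (⟦⟧-γᴿ ψ v)) (sym γ-⇾)
  ⟦⟧-γᴿ 𝟘 v = sym γ-zero
  ⟦⟧-γᴿ 𝟙 v = sym γ-one

  glivenko : ∀ φ → CPL φ → Valid A (∼ (∼ φ))
  glivenko φ ⊢φ v =
    subst (one ≤_) (⟦⟧-γᴿ φ v) (cong proj₁ (⊢φ boolean boolean-isBoolean (λ n → γᴿ (v n))))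

module ThreeElementChain where
  infixl 6 _⊓_ _⊔_
  infixr 5 _⇛_

  _⊓_ _⊔_ _⇛_ : Fin 3 → Fin 3 → Fin 3
  x ⊓ y = if does (x ≤? y) then x else y
  x ⊔ y = if does (x ≤? y) then y else x
  x ⇛ y = if does (x ≤? y) then 2F else y

  H₃ : FLe
  H₃ = record
    { Carrier = Fin 3
    ; _∧_ = _⊓_ ; _∨_ = _⊔_ ; _·_ = _⊓_ ; _⇾_ = _⇛_ ; zero = 0F ; one = 2F
    ; ∧-assoc = ⊓-assoc ; ∨-assoc = from-yes (∀³? λ x y z → x ⊔ y ⊔ z ≟ x ⊔ (y ⊔ z))
    ; ∧-comm = ⊓-comm ; ∨-comm = from-yes (∀²? λ x y → x ⊔ y ≟ y ⊔ x)
    ; ∧-absorb = from-yes (∀²? λ x y → x ⊓ (x ⊔ y) ≟ x)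
    ; ∨-absorb = from-yes (∀²? λ x y → x ⊔ (x ⊓ y) ≟ x)
    ; ·-assoc = ⊓-assoc ; ·-comm = ⊓-comm
    ; ·-identity = from-yes (all? λ x → 2F ⊓ x ≟ x)
    ; residuation₁ = from-yes (∀³? λ x y z → (x ⊓ y ⊓ z ≟ x ⊓ y) →-dec (x ⊓ (y ⇛ z) ≟ x))
    ; residuation₂ = from-yes (∀³? λ x y z → (x ⊓ (y ⇛ z) ≟ x) →-dec (x ⊓ y ⊓ z ≟ x ⊓ y))
    }
    where
      ∀²? : {P : Fin 3 → Fin 3 → Set} → (∀ x y → Dec (P x y)) → Dec (∀ x y → P x y)
      ∀²? P? = all? λ x → all? (P? x)
      ∀³? : {P : Fin 3 → Fin 3 → Fin 3 → Set} → (∀ x y z → Dec (P x y z)) → Dec (∀ x y z → P x y z)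
      ∀³? P? = all? λ x → ∀²? (P? x)
      ⊓-assoc : ∀ x y z → x ⊓ y ⊓ z ≡ x ⊓ (y ⊓ z)
      ⊓-assoc = from-yes (∀³? λ x y z → x ⊓ y ⊓ z ≟ x ⊓ (y ⊓ z))
      ⊓-comm : ∀ x y → x ⊓ y ≡ y ⊓ x
      ⊓-comm = from-yes (∀²? λ x y → x ⊓ y ≟ y ⊓ x)

  H₃-isHeyting : IsHeyting H₃
  H₃-isHeyting =
    ( from-yes (all? λ x → x ⊓ 2F ≟ x) , from-yes (all? λ x → 0F ⊓ x ≟ 0F) ) , λ _ _ → refl

  arr-asymmetric : ∀ c → arr c H₃ 1F 2F ≢ arr c H₃ 2F 1F
  arr-asymmetric ⇒∧ ()
  arr-asymmetric ⇒∘ ()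

open ThreeElementChain using (H₃; H₃-isHeyting; arr-asymmetric)

valid-aristotle₁ : ∀ A c → Aristotle₁ A c → ∀ φ → Valid A (∼ (imp c φ (∼ φ)))
valid-aristotle₁ A ⇒∧ thesis φ v = thesis (⟦ φ ⟧ A v)
valid-aristotle₁ A ⇒∘ thesis φ v = thesis (⟦ φ ⟧ A v)

aristotle₁-of-valid : ∀ A c → Valid A (∼ (imp c (var 0) (∼ (var 0)))) → Aristotle₁ A c
aristotle₁-of-valid A ⇒∧ valid x = valid (λ _ → x)
aristotle₁-of-valid A ⇒∘ valid x = valid (λ _ → x)

aristotle₂-of-valid : ∀ A c → Valid A (∼ (imp c (∼ (var 0)) (var 0))) → Aristotle₂ A c
aristotle₂-of-valid A ⇒∧ valid x = valid (λ _ → x)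
aristotle₂-of-valid A ⇒∘ valid x = valid (λ _ → x)

valid-neg³⇒valid-neg : ∀ A φ → Valid A (∼ (∼ (∼ φ))) → Valid A (∼ φ)
valid-neg³⇒valid-neg A φ valid v = ≤-trans (valid v) (≤-reflexive neg-γ)
  where open FLeProperties A

CPL-aristotle₁ : ∀ c φ → CPL (∼ (imp c φ (∼ φ)))
CPL-aristotle₁ c φ A (heyting , _) = valid-aristotle₁ A c
  (NoncontradictoryProperties.aristotle₁ A (proj₁ heyting) (heyting⇒noncontradictory A heyting) c) φ

G-FLew-CPL-aristotle₁ : ∀ c φ → G-FLew-CPL (∼ (imp c φ (∼ φ)))
G-FLew-CPL-aristotle₁ c φ K _ G-FLe-CPL⊆K _ = G-FLe-CPL⊆K thesis λ K′ K′-substructural K′-glivenko →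
  K′-substructural thesis λ A A⊨K′ → valid-neg³⇒valid-neg A (imp c φ (∼ φ))
    (A⊨K′ (∼ (∼ thesis)) (proj₁ (K′-glivenko thesis) (CPL-aristotle₁ c φ)))
  where thesis = ∼ (imp c φ (∼ φ))

module _ {L : Logic} where

  models-integral : FLew ⊆ᴸ L → ∀ A → Models L A → Integral A
  models-integral FLew⊆L A A⊨L =
      (λ x → one≤⇾⇒≤ (A⊨L (var 0 ⟶ 𝟙) (FLew⊆L (var 0 ⟶ 𝟙) x⇾𝟙) (λ _ → x)))
    , (λ x → one≤⇾⇒≤ (A⊨L (𝟘 ⟶ var 0) (FLew⊆L (𝟘 ⟶ var 0) 𝟘⇾x) (λ _ → x)))
    where
      open FLeProperties A using (one≤⇾⇒≤)
      x⇾𝟙 : FLew (var 0 ⟶ 𝟙)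
      x⇾𝟙 B B-integral v = FLeProperties.one≤⇾ B (proj₁ B-integral (v 0))
      𝟘⇾x : FLew (𝟘 ⟶ var 0)
      𝟘⇾x B B-integral v = FLeProperties.one≤⇾ B (proj₂ B-integral (v 0))

  models-noncontradictory : ∀ {c} → FLew ⊆ᴸ L → AristotleThesis L c →
    ∀ A → Models L A → Noncontradictory A
  models-noncontradictory {c} FLew⊆L (inj₁ ⊢thesis) A A⊨L =
    IntegralProperties.aristotle₁⇒noncontradictory A (models-integral FLew⊆L A A⊨L) c
      (aristotle₁-of-valid A c (A⊨L _ (⊢thesis (var 0))))
  models-noncontradictory {c} FLew⊆L (inj₂ ⊢thesis) A A⊨L =
    IntegralProperties.aristotle₂⇒noncontradictory A (models-integral FLew⊆L A A⊨L) c
      (aristotle₂-of-valid A c (A⊨L _ (⊢thesis (var 0))))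

  connexive⇒aristotle : ∀ {c} → IsSubstructural L → Connexive L c → AristotleThesis L c
  connexive⇒aristotle {c} L-substructural (proto , _) = inj₁ λ φ →
    L-substructural _ λ A A⊨L → valid-aristotle₁ A c (λ x → proj₁ (proto A A⊨L x x)) φ

  aristotle⇒connexive : ∀ {c} → FLew ⊆ᴸ L → L ⊆ᴸ IPL → AristotleThesis L c → Connexive L c
  aristotle⇒connexive {c} FLew⊆L L⊆IPL ⊢thesis =
      (λ A A⊨L x y → let open NoncontradictoryProperties A (models-integral FLew⊆L A A⊨L)
                                (models-noncontradictory FLew⊆L ⊢thesis A A⊨L)
                     in aristotle₁ c x , aristotle₂ c x , boethius₁ c x y , boethius₂ c x y)
    , H₃ , (λ φ ⊢φ → L⊆IPL φ ⊢φ H₃ H₃-isHeyting) , 1F , 2F , arr-asymmetric c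

  glivenko⇒G-FLew-CPL⊆ : IsSubstructural L → FLew ⊆ᴸ L → Glivenko L → G-FLew-CPL ⊆ᴸ L
  glivenko⇒G-FLew-CPL⊆ L-substructural FLew⊆L L-glivenko φ ⊢φ =
    ⊢φ L L-substructural (λ ψ ⊢ψ → ⊢ψ L L-substructural L-glivenko) FLew⊆L

  aristotle⇒glivenko : ∀ {c} → IsSubstructural L → FLew ⊆ᴸ L → L ⊆ᴸ IPL →
    AristotleThesis L c → Glivenko L
  aristotle⇒glivenko L-substructural FLew⊆L L⊆IPL ⊢thesis φ =
      (λ ⊢φ → L-substructural _ λ A A⊨L →
        RegularElements.glivenko A (models-integral FLew⊆L A A⊨L)
          (models-noncontradictory FLew⊆L ⊢thesis A A⊨L) φ ⊢φ)
    , (λ ⊢¬¬φ B (heyting , ¬¬x≡x) v →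
        subst (FLe._≤_ B (FLe.one B)) (¬¬x≡x (⟦ φ ⟧ B v)) (L⊆IPL _ ⊢¬¬φ B heyting v))

theorem3p29 : (L : Logic) → IsSubstructural L → FLew ⊆ᴸ L → L ⊆ᴸ IPL →
    (c : Arrow) →
    (Connexive L c ⇔ AristotleThesis L c) × (AristotleThesis L c ⇔ (G-FLew-CPL ⊆ᴸ L))
theorem3p29 L L-substructural FLew⊆L L⊆IPL c =
    mk⇔ (connexive⇒aristotle L-substructural) (aristotle⇒connexive FLew⊆L L⊆IPL)
  , mk⇔ (glivenko⇒G-FLew-CPL⊆ L-substructural FLew⊆L
          ∘ aristotle⇒glivenko L-substructural FLew⊆L L⊆IPL)
        (λ G⊆L → inj₁ λ φ → G⊆L _ (G-FLew-CPL-aristotle₁ c φ))
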